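{- For every $\varepsilon_1,\varepsilon_2>0$ there exists $\delta\ge \varepsilon_1\varepsilon_2^2/2$ such that for every tournament $T$ on $n$ vertices with $t(T)>(1/24-\delta)n^3$, the set $$V'(T)=\left\{v\in V(T): \tfrac{n-1}{2}-\varepsilon_2 n< d^+(v),\,d^-(v)<\tfrac{n-1}{2}+\varepsilon_2 n\right\}$$ satisfies $|V'(T)|>(1-\varepsilon_1)n$.
   Context: For a tournament $T$, $t(T)$ denotes the number of cyclic (directed) triangles in $T$, and $d^+(v)$, $d^-(v)$ denote the out-degree and in-degree of a vertex $v$.
   Formalization: The parameters ε₁ and ε₂ range over the positive rationals, and the witness δ is taken in ℚ. -}

module Defs where

open import Data.Bool using (Bool; true; false; not; _∧_; _∨_; if_then_else_)
open import Data.Nat using (ℕ; zero; suc)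
import Data.Nat as ℕ
open import Data.Fin using (Fin; toℕ)
import Data.Fin as Fin
open import Data.List using (List; map; allFin)
open import Data.Nat.ListAction using (sum)
open import Data.Integer using (+_)
open import Data.Rational using (ℚ; _/_; _+_; _-_; _*_; _<_)
open import Data.Rational.Properties using (_<?_)
open import Relation.Nullary using (does; ¬_)
open import Relation.Binary.PropositionalEquality using (_≡_)

-- A tournament on vertex set Fin n: `beats u v ≡ true` means the arc u → v.
record Tournament (n : ℕ) : Set where
  field
    beats   : Fin n → Fin n → Bool
    irrefl  : ∀ u → beats u u ≡ false
    tourn   : ∀ u v → ¬ (u ≡ v) → beats v u ≡ not (beats u v)
open Tournament public

count : {n : ℕ} → (Fin n → Bool) → ℕ
count {n} p = sum (map (λ i → if p i then 1 else 0) (allFin n))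

outdeg : {n : ℕ} → Tournament n → Fin n → ℕ
outdeg T v = count (λ w → beats T v w)

indeg : {n : ℕ} → Tournament n → Fin n → ℕ
indeg T v = count (λ w → beats T w v)

cyclicTriple : {n : ℕ} → Tournament n → Fin n → Fin n → Fin n → Bool
cyclicTriple T i j k =
  (beats T i j ∧ beats T j k ∧ beats T k i) ∨ (beats T i k ∧ beats T k j ∧ beats T j i)

t : {n : ℕ} → Tournament n → ℕ
t {n} T = sum (map (λ i → sum (map (λ j → sum (map (λ k →
  if does (i Fin.<? j) ∧ does (j Fin.<? k) ∧ cyclicTriple T i j k then 1 else 0)
  (allFin n))) (allFin n))) (allFin n))

ℕ→ℚ : ℕ → ℚ
ℕ→ℚ m = (+ m) / 1

inV' : {n : ℕ} → ℚ → Tournament n → Fin n → Bool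
inV' {n} ε₂ T v =
  does (lo <? ℕ→ℚ (outdeg T v)) ∧ does (ℕ→ℚ (outdeg T v) <? hi) ∧
  does (lo <? ℕ→ℚ (indeg T v)) ∧ does (ℕ→ℚ (indeg T v) <? hi)
  where
  mid = (ℕ→ℚ n - ℕ→ℚ 1) * ((+ 1) / 2)
  lo  = mid - ε₂ * ℕ→ℚ n
  hi  = mid + ε₂ * ℕ→ℚ n

sizeV' : {n : ℕ} → ℚ → Tournament n → ℕ
sizeV' ε₂ T = count (inV' ε₂ T)

-- Every triple of vertices is either a cyclic triangle or has exactly one vertex beating the
-- other two, so t(T) = C(n,3) - Σ_v C(d⁺(v),2).  As d⁺(v) + d⁻(v) = n - 1, this is the identity
-- 24 t(T) + 3 Σ_v (d⁺(v) - d⁻(v))² + n = n³.  A vertex outside V'(T) has |d⁺(v) - d⁻(v)| ≥ 2ε₂n,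
-- so if at least ε₁n vertices were outside V'(T) the sum would be at least 4ε₁ε₂²n³ = 8δn³ for
-- δ = ε₁ε₂²/2, and the identity would force t(T) < (1/24 - δ)n³.

module Submission where

open import Defs
open import Data.Bool using (Bool; true; false; not; _∧_; _∨_; if_then_else_)
open import Data.Fin using (Fin; zero; suc)
open import Data.Nat as ℕ using (ℕ; zero; suc)
import Data.Nat.Properties as ℕ
open import Algebra.Properties.Semiring.Sum ℕ.+-*-semiring using (sum; sum-syntax)
open import Relation.Nullary using (does; contradiction)
open import Relation.Binary.PropositionalEquality

module Counting where

  open import Data.Bool using (T)
  open import Data.Unit using (tt)
  open import Data.Sum using (_⊎_; inj₁; inj₂)
  open import Data.Fin using (toℕ; _<_)
  open import Data.Fin.Properties using (_<?_; _≟_; <⇒≢; <-trans; toℕ-injective)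
  open import Data.List using (map; tabulate; allFin)
  open import Data.Nat.ListAction using () renaming (sum to sumˡ)
  open import Data.Nat using (_+_; _*_; _<ᵇ_; ∣_-_∣)
  open import Data.Nat.Properties
    using (+-identityʳ; *-identityˡ; *-identityʳ; *-zeroʳ; +-comm; *-comm; +-cancelʳ-≡; <ᵇ⇒<)
  open import Data.Nat.Tactic.RingSolver using (solve-∀)
  open import Algebra.Properties.Semiring.Sum ℕ.+-*-semiring
    using (∑-distrib-+; ∑-comm; *-distribˡ-sum; sum-cong-≗; sum-replicate-zero)
  open import Function using (id; _∘_)
  open import Relation.Nullary using (yes; no)
  open ≡-Reasoning

  ⟦_⟧ : Bool → ℕ
  ⟦ b ⟧ = if b then 1 else 0

  ⟦⟧-idem : ∀ b → ⟦ b ⟧ * ⟦ b ⟧ ≡ ⟦ b ⟧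
  ⟦⟧-idem true  = refl
  ⟦⟧-idem false = refl

  lt : ∀ {n} → Fin n → Fin n → ℕ
  lt i j = ⟦ does (i <? j) ⟧

  sum-tabulate : ∀ {m n} (f : Fin m → ℕ) (g : Fin n → Fin m) →
                 sumˡ (map f (tabulate g)) ≡ ∑[ i < n ] f (g i)
  sum-tabulate {n = zero}  f g = refl
  sum-tabulate {n = suc n} f g = cong (f (g zero) +_) (sum-tabulate f (g ∘ suc))

  sum-allFin : ∀ {n} (f : Fin n → ℕ) → sumˡ (map f (allFin n)) ≡ sum f
  sum-allFin f = sum-tabulate f id

  count≡∑ : ∀ {n} (p : Fin n → Bool) → count p ≡ ∑[ i < n ] ⟦ p i ⟧
  count≡∑ p = sum-allFin (λ i → ⟦ p i ⟧)

  ∑-const : ∀ n c → ∑[ i < n ] c ≡ n * c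
  ∑-const zero    c = refl
  ∑-const (suc n) c = cong (c +_) (∑-const n c)

  ∑-one : ∀ n → ∑[ i < n ] 1 ≡ n
  ∑-one n = trans (∑-const n 1) (*-identityʳ n)

  ∑-merge : ∀ {n} (f g : Fin n → ℕ) {h : Fin n → ℕ} →
            (∀ i → f i + g i ≡ h i) → sum f + sum g ≡ sum h
  ∑-merge f g eq = trans (sym (∑-distrib-+ f g)) (sum-cong-≗ eq)

  ∑-≟≡1 : ∀ {n} (v : Fin n) → ∑[ w < n ] ⟦ does (w ≟ v) ⟧ ≡ 1
  ∑-≟≡1 {suc n} zero    = cong suc (sum-replicate-zero n)
  ∑-≟≡1 {suc n} (suc v) = ∑-≟≡1 v

  count-not+count≡n : ∀ {n} (p : Fin n → Bool) → ∑[ i < n ] ⟦ not (p i) ⟧ + count p ≡ n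
  count-not+count≡n {n} p = begin
    ∑[ i < n ] ⟦ not (p i) ⟧ + count p         ≡⟨ cong (∑[ i < n ] ⟦ not (p i) ⟧ +_) (count≡∑ p) ⟩
    ∑[ i < n ] ⟦ not (p i) ⟧ + ∑[ i < n ] ⟦ p i ⟧ ≡⟨ ∑-merge _ _ (λ i → not+id (p i)) ⟩
    ∑[ i < n ] 1                               ≡⟨ ∑-one n ⟩
    n                                          ∎
    where
    not+id : ∀ b → ⟦ not b ⟧ + ⟦ b ⟧ ≡ 1
    not+id true  = refl
    not+id false = refl

  ∑³ : ∀ {n} → (Fin n → Fin n → Fin n → ℕ) → ℕ
  ∑³ {n} f = ∑[ i < n ] ∑[ j < n ] ∑[ k < n ] f i j k

  ∑³-cong : ∀ {n} {f g : Fin n → Fin n → Fin n → ℕ} →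
            (∀ i j k → f i j k ≡ g i j k) → ∑³ f ≡ ∑³ g
  ∑³-cong eq = sum-cong-≗ (λ i → sum-cong-≗ (λ j → sum-cong-≗ (eq i j)))

  ∑³-distrib-+ : ∀ {n} (f g : Fin n → Fin n → Fin n → ℕ) →
                 ∑³ (λ i j k → f i j k + g i j k) ≡ ∑³ f + ∑³ g
  ∑³-distrib-+ {n} f g =
    trans (sum-cong-≗ (λ i → trans (sum-cong-≗ (λ j → ∑-distrib-+ (f i j) (g i j)))
                                   (∑-distrib-+ (λ j → sum (f i j)) (λ j → sum (g i j)))))
          (∑-distrib-+ (λ i → ∑[ j < n ] sum (f i j)) (λ i → ∑[ j < n ] sum (g i j)))

  ∑³-distrib-+₃ : ∀ {n} (f g h : Fin n → Fin n → Fin n → ℕ) →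
                  ∑³ (λ i j k → f i j k + g i j k + h i j k) ≡ ∑³ f + ∑³ g + ∑³ h
  ∑³-distrib-+₃ f g h =
    trans (∑³-distrib-+ (λ i j k → f i j k + g i j k) h) (cong (_+ ∑³ h) (∑³-distrib-+ f g))

  ∑³-swap : ∀ {n} (f : Fin n → Fin n → Fin n → ℕ) → ∑³ (λ i j k → f j i k) ≡ ∑³ f
  ∑³-swap {n} f = ∑-comm (λ i j → ∑[ k < n ] f j i k)

  ∑³-rotate : ∀ {n} (f : Fin n → Fin n → Fin n → ℕ) → ∑³ (λ i j k → f k i j) ≡ ∑³ f
  ∑³-rotate {n} f = begin
    ∑[ i < n ] ∑[ j < n ] ∑[ k < n ] f k i j  ≡⟨ sum-cong-≗ (λ i → ∑-comm (λ j k → f k i j)) ⟩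
    ∑[ i < n ] ∑[ k < n ] ∑[ j < n ] f k i j  ≡⟨ ∑-comm (λ i k → ∑[ j < n ] f k i j) ⟩
    ∑[ k < n ] ∑[ i < n ] ∑[ j < n ] f k i j  ∎

  pairSum : ∀ {n} → (Fin n → ℕ) → ℕ
  pairSum {n} f = ∑[ a < n ] ∑[ b < n ] (lt a b * (f a * f b))

  pairSum-suc : ∀ {n} (f : Fin (suc n) → ℕ) →
                pairSum f ≡ f zero * sum (f ∘ suc) + pairSum (f ∘ suc)
  pairSum-suc f = cong (_+ pairSum (f ∘ suc))
    (trans (sum-cong-≗ (λ b → *-identityˡ (f zero * f (suc b)))) (sym (*-distribˡ-sum (f zero) (f ∘ suc))))

  square-of-sum : ∀ {n} (f : Fin n → ℕ) → 2 * pairSum f + ∑[ a < n ] (f a * f a) ≡ sum f * sum f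
  square-of-sum {zero}  f = refl
  square-of-sum {suc n} f = begin
    2 * pairSum f + (a * a + Q)           ≡⟨ cong (λ p → 2 * p + (a * a + Q)) (pairSum-suc f) ⟩
    2 * (a * S + P) + (a * a + Q)         ≡⟨ regroup a S P Q ⟩
    (2 * P + Q) + a * (a + 2 * S)         ≡⟨ cong (_+ a * (a + 2 * S)) (square-of-sum (f ∘ suc)) ⟩
    S * S + a * (a + 2 * S)               ≡⟨ complete a S ⟩
    (a + S) * (a + S)                     ∎
    where
    a = f zero
    S = sum (f ∘ suc)
    P = pairSum (f ∘ suc)
    Q = ∑[ b < n ] (f (suc b) * f (suc b))
    regroup : ∀ a S P Q → 2 * (a * S + P) + (a * a + Q) ≡ (2 * P + Q) + a * (a + 2 * S)
    regroup = solve-∀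
    complete : ∀ a S → S * S + a * (a + 2 * S) ≡ (a + S) * (a + S)
    complete = solve-∀

  2*pairs+count≡count² : ∀ {n} (p : Fin n → Bool) →
                         2 * pairSum (λ i → ⟦ p i ⟧) + count p ≡ count p * count p
  2*pairs+count≡count² {n} p = begin
    2 * P + count p
      ≡⟨ cong (2 * P +_) (trans (count≡∑ p) (sum-cong-≗ (sym ∘ ⟦⟧-idem ∘ p))) ⟩
    2 * P + ∑[ i < n ] (⟦ p i ⟧ * ⟦ p i ⟧)       ≡⟨ square-of-sum (λ i → ⟦ p i ⟧) ⟩
    (∑[ i < n ] ⟦ p i ⟧) * (∑[ i < n ] ⟦ p i ⟧) ≡⟨ cong₂ _*_ (count≡∑ p) (count≡∑ p) ⟨
    count p * count p                           ∎
    where P = pairSum (λ i → ⟦ p i ⟧)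

  2*pairs+n≡n² : ∀ n → 2 * pairSum {n} (λ _ → 1) + n ≡ n * n
  2*pairs+n≡n² n = begin
    2 * pairSum {n} (λ _ → 1) + n          ≡⟨ cong (2 * pairSum {n} (λ _ → 1) +_) (sym (∑-one n)) ⟩
    2 * pairSum {n} (λ _ → 1) + ∑[ a < n ] 1 ≡⟨ square-of-sum {n} (λ _ → 1) ⟩
    (∑[ a < n ] 1) * (∑[ a < n ] 1)        ≡⟨ cong₂ _*_ (∑-one n) (∑-one n) ⟩
    n * n                                  ∎

  triples : ℕ → ℕ
  triples n = ∑³ {n} (λ i j k → lt i j * lt j k)

  triples-suc : ∀ n → triples (suc n) ≡ pairSum {n} (λ _ → 1) + triples n
  triples-suc n = cong₂ _+_ first-row other-rows
    where
    first-row : ∑[ j < suc n ] ∑[ k < suc n ] (lt {suc n} zero j * lt j k) ≡ pairSum {n} (λ _ → 1)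
    first-row = cong₂ _+_ (sum-replicate-zero (suc n))
      (sum-cong-≗ {n} (λ j → sum-cong-≗ {n} (λ k → *-comm 1 (lt j k))))
    other-rows : ∑[ i < n ] ∑[ j < suc n ] ∑[ k < suc n ] (lt {suc n} (suc i) j * lt j k) ≡ triples n
    other-rows = sum-cong-≗ {n} (λ i → cong₂ _+_ (sum-replicate-zero (suc n))
      (sum-cong-≗ {n} (λ j → cong (_+ ∑[ k < n ] (lt i j * lt j k)) (*-zeroʳ (lt i j)))))

  6*triples+3n²≡n³+2n : ∀ n → 6 * triples n + 3 * (n * n) ≡ n * n * n + 2 * n
  6*triples+3n²≡n³+2n zero    = refl
  6*triples+3n²≡n³+2n (suc n) = begin
    6 * triples (suc n) + 3 * (suc n * suc n)   ≡⟨ cong (λ x → 6 * x + 3 * (suc n * suc n)) (triples-suc n) ⟩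
    6 * (P + Q) + 3 * (suc n * suc n)           ≡⟨ regroup n P Q ⟩
    3 * (2 * P + n) + (6 * Q + 3 * (n * n)) + 3 * suc n
      ≡⟨ cong₂ (λ x y → 3 * x + y + 3 * suc n) (2*pairs+n≡n² n) (6*triples+3n²≡n³+2n n) ⟩
    3 * (n * n) + (n * n * n + 2 * n) + 3 * suc n ≡⟨ complete n ⟩
    suc n * suc n * suc n + 2 * suc n            ∎
    where
    P = pairSum {n} (λ _ → 1)
    Q = triples n
    regroup : ∀ n P Q → 6 * (P + Q) + 3 * (suc n * suc n) ≡ 3 * (2 * P + n) + (6 * Q + 3 * (n * n)) + 3 * suc n
    regroup = solve-∀
    complete : ∀ n → 3 * (n * n) + (n * n * n + 2 * n) + 3 * suc n ≡ suc n * suc n * suc n + 2 * suc n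
    complete = solve-∀

  outdeg≡∑ : ∀ {n} (T : Tournament n) v → outdeg T v ≡ ∑[ w < n ] ⟦ beats T v w ⟧
  outdeg≡∑ T v = count≡∑ (beats T v)

  indeg≡∑ : ∀ {n} (T : Tournament n) v → indeg T v ≡ ∑[ w < n ] ⟦ beats T w v ⟧
  indeg≡∑ T v = count≡∑ (λ w → beats T w v)

  arc-or-equal : ∀ {n} (T : Tournament n) v w →
                 ⟦ beats T v w ⟧ + ⟦ beats T w v ⟧ + ⟦ does (w ≟ v) ⟧ ≡ 1
  arc-or-equal T v w with w ≟ v
  ... | yes refl rewrite irrefl T w = refl
  ... | no w≢v rewrite tourn T v w (w≢v ∘ sym) with beats T v w
  ...   | true  = refl
  ...   | false = refl

  outdeg+indeg+1≡n : ∀ {n} (T : Tournament n) v → outdeg T v + indeg T v + 1 ≡ n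
  outdeg+indeg+1≡n {n} T v = begin
    outdeg T v + indeg T v + 1
      ≡⟨ cong₂ _+_ (cong₂ _+_ (outdeg≡∑ T v) (indeg≡∑ T v)) (sym (∑-≟≡1 v)) ⟩
    ∑[ w < n ] ⟦ beats T v w ⟧ + ∑[ w < n ] ⟦ beats T w v ⟧ + ∑[ w < n ] ⟦ does (w ≟ v) ⟧
      ≡⟨ cong (_+ ∑[ w < n ] ⟦ does (w ≟ v) ⟧)
              (∑-merge (λ w → ⟦ beats T v w ⟧) (λ w → ⟦ beats T w v ⟧) (λ _ → refl)) ⟩
    ∑[ w < n ] (⟦ beats T v w ⟧ + ⟦ beats T w v ⟧) + ∑[ w < n ] ⟦ does (w ≟ v) ⟧
      ≡⟨ ∑-merge _ (λ w → ⟦ does (w ≟ v) ⟧) (arc-or-equal T v) ⟩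
    ∑[ w < n ] 1
      ≡⟨ ∑-one n ⟩
    n ∎

  ∑outdeg≡∑indeg : ∀ {n} (T : Tournament n) → ∑[ v < n ] outdeg T v ≡ ∑[ v < n ] indeg T v
  ∑outdeg≡∑indeg {n} T = begin
    ∑[ v < n ] outdeg T v                  ≡⟨ sum-cong-≗ (outdeg≡∑ T) ⟩
    ∑[ v < n ] ∑[ w < n ] ⟦ beats T v w ⟧  ≡⟨ ∑-comm (λ v w → ⟦ beats T v w ⟧) ⟩
    ∑[ w < n ] ∑[ v < n ] ⟦ beats T v w ⟧  ≡⟨ sum-cong-≗ (indeg≡∑ T) ⟨
    ∑[ w < n ] indeg T w                   ∎

  2*∑outdeg+n≡n² : ∀ {n} (T : Tournament n) → 2 * ∑[ v < n ] outdeg T v + n ≡ n * n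
  2*∑outdeg+n≡n² {n} T = begin
    2 * D + n
      ≡⟨ cong₂ _+_ (cong (D +_) (trans (+-identityʳ D) (∑outdeg≡∑indeg T))) (sym (∑-one n)) ⟩
    D + ∑[ v < n ] indeg T v + ∑[ v < n ] 1
      ≡⟨ cong (_+ ∑[ v < n ] 1) (∑-merge (outdeg T) (indeg T) (λ _ → refl)) ⟩
    ∑[ v < n ] (outdeg T v + indeg T v) + ∑[ v < n ] 1
      ≡⟨ ∑-merge _ _ (outdeg+indeg+1≡n T) ⟩
    ∑[ v < n ] n
      ≡⟨ ∑-const n n ⟩
    n * n ∎
    where D = ∑[ v < n ] outdeg T v

  imbalance : ∀ {n} → Tournament n → Fin n → ℕ
  imbalance T v = ∣ outdeg T v - indeg T v ∣

  ∣m-n∣²+4mn≡[m+n]² : ∀ d e → ∣ d - e ∣ * ∣ d - e ∣ + 4 * (d * e) ≡ (d + e) * (d + e)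
  ∣m-n∣²+4mn≡[m+n]² zero    e       = +-identityʳ (e * e)
  ∣m-n∣²+4mn≡[m+n]² (suc d) zero    = lemma d
    where lemma : ∀ d → suc d * suc d + 4 * (suc d * 0) ≡ (suc d + 0) * (suc d + 0)
          lemma = solve-∀
  ∣m-n∣²+4mn≡[m+n]² (suc d) (suc e) = begin
    a * a + 4 * (suc d * suc e)              ≡⟨ expand a d e ⟩
    (a * a + 4 * (d * e)) + 4 * (1 + d + e)  ≡⟨ cong (_+ 4 * (1 + d + e)) (∣m-n∣²+4mn≡[m+n]² d e) ⟩
    (d + e) * (d + e) + 4 * (1 + d + e)      ≡⟨ collect d e ⟩
    (suc d + suc e) * (suc d + suc e)        ∎
    where
    a = ∣ d - e ∣
    expand : ∀ a d e → a * a + 4 * (suc d * suc e) ≡ (a * a + 4 * (d * e)) + 4 * (1 + d + e)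
    expand = solve-∀
    collect : ∀ d e → (d + e) * (d + e) + 4 * (1 + d + e) ≡ (suc d + suc e) * (suc d + suc e)
    collect = solve-∀

  cyclicAt : ∀ {n} → Tournament n → Fin n → Fin n → Fin n → ℕ
  cyclicAt T i j k = ⟦ does (i <? j) ∧ does (j <? k) ∧ cyclicTriple T i j k ⟧

  t≡∑³ : ∀ {n} (T : Tournament n) → t T ≡ ∑³ (cyclicAt T)
  t≡∑³ {n} T = trans (sum-allFin (λ i → sumˡ (map (λ j → sumˡ (map (cyclicAt T i j) (allFin n))) (allFin n))))
    (sum-cong-≗ (λ i → trans (sum-allFin (λ j → sumˡ (map (cyclicAt T i j) (allFin n))))
                             (sum-cong-≗ (λ j → sum-allFin (cyclicAt T i j)))))

  dominates : ∀ {n} → Tournament n → Fin n → Fin n → Fin n → ℕ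
  dominates T v a b = ⟦ beats T v a ⟧ * ⟦ beats T v b ⟧

  -- The factors 1 * 1 are lt i j * lt j k at an increasing triple, as in cyclic-or-source.
  cyclic-or-source-ᵇ : ∀ a b c →
    ⟦ (a ∧ b ∧ not c) ∨ (c ∧ not b ∧ not a) ⟧
      + 1 * 1 * (⟦ a ⟧ * ⟦ c ⟧ + ⟦ not a ⟧ * ⟦ b ⟧ + ⟦ not c ⟧ * ⟦ not b ⟧) ≡ 1 * 1
  cyclic-or-source-ᵇ true  true  true  = refl
  cyclic-or-source-ᵇ true  true  false = refl
  cyclic-or-source-ᵇ true  false true  = refl
  cyclic-or-source-ᵇ true  false false = refl
  cyclic-or-source-ᵇ false true  true  = refl
  cyclic-or-source-ᵇ false true  false = refl
  cyclic-or-source-ᵇ false false true  = refl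
  cyclic-or-source-ᵇ false false false = refl

  <ᵇ-true⇒< : ∀ {n} {i j : Fin n} → (toℕ i <ᵇ toℕ j) ≡ true → i < j
  <ᵇ-true⇒< {i = i} {j} e = <ᵇ⇒< (toℕ i) (toℕ j) (subst T (sym e) tt)

  cyclic-or-source : ∀ {n} (T : Tournament n) i j k →
    cyclicAt T i j k + lt i j * lt j k * (dominates T i j k + dominates T j i k + dominates T k i j)
      ≡ lt i j * lt j k
  cyclic-or-source T i j k with toℕ i <ᵇ toℕ j in i<j | toℕ j <ᵇ toℕ k in j<k
  ... | false | _     = refl
  ... | true  | false = refl
  ... | true  | true
    rewrite tourn T i j (<⇒≢ (<ᵇ-true⇒< i<j)) | tourn T j k (<⇒≢ (<ᵇ-true⇒< j<k))
          | tourn T i k (<⇒≢ (<-trans (<ᵇ-true⇒< i<j) (<ᵇ-true⇒< j<k)))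
    = cyclic-or-source-ᵇ (beats T i j) (beats T j k) (beats T i k)

  <ᵇ-trichotomy : ∀ x z → x ≢ z → ⟦ x <ᵇ z ⟧ + ⟦ z <ᵇ x ⟧ ≡ 1
  <ᵇ-trichotomy zero    zero    x≢z = contradiction refl x≢z
  <ᵇ-trichotomy zero    (suc z) x≢z = refl
  <ᵇ-trichotomy (suc x) zero    x≢z = refl
  <ᵇ-trichotomy (suc x) (suc z) x≢z = <ᵇ-trichotomy x z (x≢z ∘ cong suc)

  -- The three products say that x lies before y < z, between them, or after them.
  <ᵇ-position : ∀ x y z → x ≢ y → x ≢ z →
    ⟦ x <ᵇ y ⟧ * ⟦ y <ᵇ z ⟧ + ⟦ y <ᵇ x ⟧ * ⟦ x <ᵇ z ⟧ + ⟦ y <ᵇ z ⟧ * ⟦ z <ᵇ x ⟧ ≡ ⟦ y <ᵇ z ⟧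
  <ᵇ-position zero    zero    z       x≢y x≢z = contradiction refl x≢y
  <ᵇ-position zero    (suc y) zero    x≢y x≢z = contradiction refl x≢z
  <ᵇ-position zero    (suc y) (suc z) x≢y x≢z = lemma ⟦ y <ᵇ z ⟧
    where lemma : ∀ L → 1 * L + 0 * 1 + L * 0 ≡ L
          lemma = solve-∀
  <ᵇ-position (suc x) zero    zero    x≢y x≢z = refl
  <ᵇ-position (suc x) zero    (suc z) x≢y x≢z =
    trans (lemma ⟦ x <ᵇ z ⟧ ⟦ z <ᵇ x ⟧) (<ᵇ-trichotomy x z (x≢z ∘ cong suc))
    where lemma : ∀ A B → 0 * 1 + 1 * A + 1 * B ≡ A + B
          lemma = solve-∀
  <ᵇ-position (suc x) (suc y) zero    x≢y x≢z = lemma ⟦ x <ᵇ y ⟧ ⟦ y <ᵇ x ⟧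
    where lemma : ∀ A B → A * 0 + B * 0 + 0 * 1 ≡ 0
          lemma = solve-∀
  <ᵇ-position (suc x) (suc y) (suc z) x≢y x≢z = <ᵇ-position x y z (x≢y ∘ cong suc) (x≢z ∘ cong suc)

  *-congʳ-or-zero : ∀ {x y d} → d ≡ 0 ⊎ x ≡ y → x * d ≡ y * d
  *-congʳ-or-zero {x} {y} (inj₁ refl) = trans (*-zeroʳ x) (sym (*-zeroʳ y))
  *-congʳ-or-zero         (inj₂ refl) = refl

  dominates-self-or-position : ∀ {n} (T : Tournament n) v a b →
    dominates T v a b ≡ 0 ⊎ lt v a * lt a b + lt a v * lt v b + lt a b * lt b v ≡ lt a b
  dominates-self-or-position T v a b with v ≟ a | v ≟ b
  ... | yes refl | _        = inj₁ (cong (λ x → ⟦ x ⟧ * ⟦ beats T v b ⟧) (irrefl T v))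
  ... | no _     | yes refl =
    inj₁ (trans (cong (λ x → ⟦ beats T v a ⟧ * ⟦ x ⟧) (irrefl T v)) (*-zeroʳ ⟦ beats T v a ⟧))
  ... | no v≢a   | no v≢b   =
    inj₂ (<ᵇ-position (toℕ v) (toℕ a) (toℕ b) (v≢a ∘ toℕ-injective) (v≢b ∘ toℕ-injective))

  -- A triple in which v beats the other two vertices is counted once among the pairs beaten
  -- by v, whatever the position of v among the three indices.
  ∑-sources : ∀ {n} (T : Tournament n) →
    ∑³ (λ i j k → lt i j * lt j k * (dominates T i j k + dominates T j i k + dominates T k i j))
      ≡ ∑[ v < n ] pairSum (λ w → ⟦ beats T v w ⟧)
  ∑-sources {n} T = begin
    ∑³ (λ i j k → lt i j * lt j k * (D i j k + D j i k + D k i j))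
      ≡⟨ ∑³-cong (λ i j k → distrib (lt i j * lt j k) (D i j k) (D j i k) (D k i j)) ⟩
    ∑³ (λ i j k → lt i j * lt j k * D i j k + lt i j * lt j k * D j i k + lt i j * lt j k * D k i j)
      ≡⟨ ∑³-distrib-+₃ first (λ i j k → second j i k) (λ i j k → third k i j) ⟩
    ∑³ first + ∑³ (λ i j k → second j i k) + ∑³ (λ i j k → third k i j)
      ≡⟨ cong₂ (λ x y → ∑³ first + x + y) (∑³-swap second) (∑³-rotate third) ⟩
    ∑³ first + ∑³ second + ∑³ third
      ≡⟨ ∑³-distrib-+₃ first second third ⟨
    ∑³ (λ v a b → first v a b + second v a b + third v a b)
      ≡⟨ ∑³-cong (λ v a b → trans (sym (distribʳ (lt v a * lt a b) (lt a v * lt v b) (lt a b * lt b v) (D v a b)))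
                                    (*-congʳ-or-zero (dominates-self-or-position T v a b))) ⟩
    ∑³ (λ v a b → lt a b * D v a b) ∎
    where
    D first second third : Fin n → Fin n → Fin n → ℕ
    D = dominates T
    first  v a b = lt v a * lt a b * D v a b
    second v a b = lt a v * lt v b * D v a b
    third  v a b = lt a b * lt b v * D v a b
    distrib : ∀ x a b c → x * (a + b + c) ≡ x * a + x * b + x * c
    distrib = solve-∀
    distribʳ : ∀ a b c x → (a + b + c) * x ≡ a * x + b * x + c * x
    distribʳ = solve-∀

  t+∑pairs≡triples : ∀ {n} (T : Tournament n) →
                     t T + ∑[ v < n ] pairSum (λ w → ⟦ beats T v w ⟧) ≡ triples n
  t+∑pairs≡triples {n} T = begin
    t T + ∑[ v < n ] pairSum (λ w → ⟦ beats T v w ⟧)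
      ≡⟨ cong₂ _+_ (t≡∑³ T) (sym (∑-sources T)) ⟩
    ∑³ (cyclicAt T) + ∑³ sources
      ≡⟨ ∑³-distrib-+ (cyclicAt T) sources ⟨
    ∑³ (λ i j k → cyclicAt T i j k + sources i j k)
      ≡⟨ ∑³-cong (cyclic-or-source T) ⟩
    triples n ∎
    where
    sources : Fin n → Fin n → Fin n → ℕ
    sources i j k = lt i j * lt j k * (dominates T i j k + dominates T j i k + dominates T k i j)

  -- Writing hᵢ for (left side - right side) of the i-th hypothesis of
  -- triangle-identity-from-counts, 24t + 3S + n - n³ = 24h₁ - 12h₂ + 4h₃ + (6 - 6m)h₄ + 3h₅ - 12h₆;
  -- the negative terms are moved across so that no truncated subtraction occurs.
  triangle-identity-certificate : ∀ m t P Q D D2 DE S →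
    24 * t + 3 * S + suc m
      + (24 * Q + 12 * (2 * P + D) + 4 * (suc m * suc m * suc m + 2 * suc m) + 6 * (suc m * suc m)
         + 6 * m * (2 * D + suc m) + 3 * (suc m * (m * m)) + 12 * (DE + D2))
    ≡ suc m * suc m * suc m
      + (24 * (t + P) + 12 * D2 + 4 * (6 * Q + 3 * (suc m * suc m)) + 6 * (2 * D + suc m)
         + 6 * m * (suc m * suc m) + 3 * (S + 4 * DE) + 12 * (m * D))
  triangle-identity-certificate = solve-∀

  triangle-identity-from-counts : ∀ m {t P Q D D2 DE S} → let n = suc m in
    t + P ≡ Q → 2 * P + D ≡ D2 → 6 * Q + 3 * (n * n) ≡ n * n * n + 2 * n → 2 * D + n ≡ n * n →
    S + 4 * DE ≡ n * (m * m) → DE + D2 ≡ m * D → 24 * t + 3 * S + n ≡ n * n * n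
  triangle-identity-from-counts m {t} {P} {Q} {D} {D2} {DE} {S} h₁ h₂ h₃ h₄ h₅ h₆ =
    +-cancelʳ-≡ X (24 * t + 3 * S + n) (n * n * n) (begin
      24 * t + 3 * S + n + X  ≡⟨ triangle-identity-certificate m t P Q D D2 DE S ⟩
      n * n * n + Y
        ≡⟨ cong (n * n * n +_) (combination-cong h₁ (sym h₂) h₃ h₄ (sym h₄) h₅ (sym h₆)) ⟩
      n * n * n + X           ∎)
    where
    n = suc m
    combination : ℕ → ℕ → ℕ → ℕ → ℕ → ℕ → ℕ → ℕ
    combination a b c d e f g = 24 * a + 12 * b + 4 * c + 6 * d + 6 * m * e + 3 * f + 12 * g
    combination-cong : ∀ {a a′ b b′ c c′ d d′ e e′ f f′ g g′} →
      a ≡ a′ → b ≡ b′ → c ≡ c′ → d ≡ d′ → e ≡ e′ → f ≡ f′ → g ≡ g′ →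
      combination a b c d e f g ≡ combination a′ b′ c′ d′ e′ f′ g′
    combination-cong refl refl refl refl refl refl refl = refl
    X = combination Q (2 * P + D) (n * n * n + 2 * n) (n * n) (2 * D + n) (n * (m * m)) (DE + D2)
    Y = combination (t + P) D2 (6 * Q + 3 * (n * n)) (2 * D + n) (n * n) (S + 4 * DE) (m * D)

  triangle-identity : ∀ {n} (T : Tournament n) →
    24 * t T + 3 * ∑[ v < n ] (imbalance T v * imbalance T v) + n ≡ n * n * n
  triangle-identity {zero}  T = refl
  triangle-identity {suc m} T =
    triangle-identity-from-counts m {t T} {sum pairs} {triples n} {sum d} {∑[ v < n ] (d v * d v)}
                                    {∑[ v < n ] (d v * e v)} {sum imbalance²}
    (t+∑pairs≡triples T) ∑pairs (6*triples+3n²≡n³+2n n) (2*∑outdeg+n≡n² T) ∑squares ∑products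
    where
    n = suc m
    d e pairs imbalance² : Fin n → ℕ
    d = outdeg T
    e = indeg T
    pairs v = pairSum (λ w → ⟦ beats T v w ⟧)
    imbalance² v = imbalance T v * imbalance T v
    d+e≡m : ∀ v → d v + e v ≡ m
    d+e≡m v = +-cancelʳ-≡ 1 (d v + e v) m (trans (outdeg+indeg+1≡n T v) (+-comm 1 m))
    ∑pairs : 2 * sum pairs + sum d ≡ ∑[ v < n ] (d v * d v)
    ∑pairs = trans (cong (_+ sum d) (*-distribˡ-sum 2 pairs))
                   (∑-merge (λ v → 2 * pairs v) d (λ v → 2*pairs+count≡count² (beats T v)))
    ∑squares : sum imbalance² + 4 * ∑[ v < n ] (d v * e v) ≡ n * (m * m)
    ∑squares = begin
      sum imbalance² + 4 * ∑[ v < n ] (d v * e v)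
        ≡⟨ cong (sum imbalance² +_) (*-distribˡ-sum 4 (λ v → d v * e v)) ⟩
      sum imbalance² + ∑[ v < n ] (4 * (d v * e v))
        ≡⟨ ∑-merge imbalance² (λ v → 4 * (d v * e v))
                   (λ v → trans (∣m-n∣²+4mn≡[m+n]² (d v) (e v)) (cong (λ x → x * x) (d+e≡m v))) ⟩
      ∑[ v < n ] (m * m)
        ≡⟨ ∑-const n (m * m) ⟩
      n * (m * m) ∎
    ∑products : ∑[ v < n ] (d v * e v) + ∑[ v < n ] (d v * d v) ≡ m * sum d
    ∑products = trans (∑-merge (λ v → d v * e v) (λ v → d v * d v)
                                (λ v → trans (factor (d v) (e v)) (cong (_* d v) (d+e≡m v))))
                      (sym (*-distribˡ-sum m d))
      where factor : ∀ x y → x * y + x * x ≡ (x + y) * x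
            factor = solve-∀

open Counting using (⟦_⟧; imbalance; outdeg+indeg+1≡n; count-not+count≡n; triangle-identity)

open import Data.Integer as ℤ using (+_)
import Data.Integer.Properties as ℤ
open import Data.Rational
open import Data.Rational.Properties
import Data.Rational.Unnormalised as ℚᵘ
import Data.Rational.Unnormalised.Properties as ℚᵘ
open import Data.Rational.Solver using (module +-*-Solver)
open import Data.Product using (Σ; _×_; _,_; proj₁; proj₂)
open import Relation.Nullary.Decidable using (dec-true; decidable-stable)
open import Function using (_∘_)

ℕ→ℚᵘ : ℕ → ℚᵘ.ℚᵘ
ℕ→ℚᵘ a = ℚᵘ.mkℚᵘ (+ a) 0

toℚᵘ-ℕ→ℚ : ∀ a → toℚᵘ (ℕ→ℚ a) ℚᵘ.≃ ℕ→ℚᵘ a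
toℚᵘ-ℕ→ℚ a = toℚᵘ-fromℚᵘ (ℕ→ℚᵘ a)

ℕ→ℚ-homo-+ : ∀ a b → ℕ→ℚ (a ℕ.+ b) ≡ ℕ→ℚ a + ℕ→ℚ b
ℕ→ℚ-homo-+ a b = toℚᵘ-injective (ℚᵘ.≃-trans (toℚᵘ-ℕ→ℚ (a ℕ.+ b)) (ℚᵘ.≃-trans (ℚᵘ.*≡* eq)
  (ℚᵘ.≃-sym (ℚᵘ.≃-trans (toℚᵘ-homo-+ (ℕ→ℚ a) (ℕ→ℚ b))
                        (ℚᵘ.+-cong (toℚᵘ-ℕ→ℚ a) (toℚᵘ-ℕ→ℚ b))))))
  where
  eq : + (a ℕ.+ b) ℤ.* + 1 ≡ (+ a ℤ.* + 1 ℤ.+ + b ℤ.* + 1) ℤ.* + 1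
  eq rewrite ℤ.*-identityʳ (+ a) | ℤ.*-identityʳ (+ b) | ℤ.*-identityʳ (+ (a ℕ.+ b)) = ℤ.pos-+ a b

ℕ→ℚ-homo-* : ∀ a b → ℕ→ℚ (a ℕ.* b) ≡ ℕ→ℚ a * ℕ→ℚ b
ℕ→ℚ-homo-* a b = toℚᵘ-injective (ℚᵘ.≃-trans (toℚᵘ-ℕ→ℚ (a ℕ.* b)) (ℚᵘ.≃-trans (ℚᵘ.*≡* eq)
  (ℚᵘ.≃-sym (ℚᵘ.≃-trans (toℚᵘ-homo-* (ℕ→ℚ a) (ℕ→ℚ b))
                        (ℚᵘ.*-cong (toℚᵘ-ℕ→ℚ a) (toℚᵘ-ℕ→ℚ b))))))
  where
  eq : + (a ℕ.* b) ℤ.* + 1 ≡ (+ a ℤ.* + b) ℤ.* + 1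
  eq rewrite ℤ.*-identityʳ (+ (a ℕ.* b)) | ℤ.*-identityʳ (+ a ℤ.* + b) = ℤ.pos-* a b

ℕ→ℚ-mono-≤ : ∀ {a b} → a ℕ.≤ b → ℕ→ℚ a ≤ ℕ→ℚ b
ℕ→ℚ-mono-≤ {a} {b} a≤b = toℚᵘ-cancel-≤
  (ℚᵘ.≤-respˡ-≃ (ℚᵘ.≃-sym (toℚᵘ-ℕ→ℚ a)) (ℚᵘ.≤-respʳ-≃ (ℚᵘ.≃-sym (toℚᵘ-ℕ→ℚ b))
    (ℚᵘ.*≤* (subst₂ ℤ._≤_ (sym (ℤ.*-identityʳ (+ a))) (sym (ℤ.*-identityʳ (+ b))) (ℤ.+≤+ a≤b)))))

ℕ→ℚ-nonNeg : ∀ a → 0ℚ ≤ ℕ→ℚ a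
ℕ→ℚ-nonNeg a = ℕ→ℚ-mono-≤ (ℕ.z≤n {a})

open +-*-Solver using (solve; _:+_; _:-_; _:*_; _:=_; con)
open ≤-Reasoning

near-midpoint : ∀ {x y M k} → x + y ≡ M → x - y < k + k → y - x < k + k → M * ½ - k < x × x < M * ½ + k
near-midpoint {x} {y} {k = k} refl x-y<2k y-x<2k =
  *-cancelˡ-<-nonNeg (ℕ→ℚ 2) above , *-cancelˡ-<-nonNeg (ℕ→ℚ 2) below
  where
  above : ℕ→ℚ 2 * ((x + y) * ½ - k) < ℕ→ℚ 2 * x
  above = begin-strict
    ℕ→ℚ 2 * ((x + y) * ½ - k)
      ≡⟨ solve 3 (λ x y k → con (ℕ→ℚ 2) :* ((x :+ y) :* con ½ :- k) := (x :+ x :- (k :+ k)) :+ (y :- x))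
                 refl x y k ⟩
    (x + x - (k + k)) + (y - x)   <⟨ +-monoʳ-< (x + x - (k + k)) y-x<2k ⟩
    (x + x - (k + k)) + (k + k)
      ≡⟨ solve 2 (λ x k → (x :+ x :- (k :+ k)) :+ (k :+ k) := con (ℕ→ℚ 2) :* x) refl x k ⟩
    ℕ→ℚ 2 * x ∎
  below : ℕ→ℚ 2 * x < ℕ→ℚ 2 * ((x + y) * ½ + k)
  below = begin-strict
    ℕ→ℚ 2 * x                 ≡⟨ solve 2 (λ x y → con (ℕ→ℚ 2) :* x := (x :+ y) :+ (x :- y)) refl x y ⟩
    (x + y) + (x - y)         <⟨ +-monoʳ-< (x + y) x-y<2k ⟩
    (x + y) + (k + k)
      ≡⟨ solve 3 (λ x y k → (x :+ y) :+ (k :+ k) := con (ℕ→ℚ 2) :* ((x :+ y) :* con ½ :+ k)) refl x y k ⟩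
    ℕ→ℚ 2 * ((x + y) * ½ + k) ∎

ℕ→ℚ-m-n≤∣m-n∣ : ∀ d e → ℕ→ℚ d - ℕ→ℚ e ≤ ℕ→ℚ ℕ.∣ d - e ∣
ℕ→ℚ-m-n≤∣m-n∣ d e = begin
  ℕ→ℚ d - ℕ→ℚ e
    ≤⟨ +-monoˡ-≤ (- ℕ→ℚ e) (≤-trans (ℕ→ℚ-mono-≤ (ℕ.m≤∣m-n∣+n d e))
                                    (≤-reflexive (ℕ→ℚ-homo-+ ℕ.∣ d - e ∣ e))) ⟩
  ℕ→ℚ ℕ.∣ d - e ∣ + ℕ→ℚ e - ℕ→ℚ e
    ≡⟨ solve 2 (λ a e → a :+ e :- e := a) refl (ℕ→ℚ ℕ.∣ d - e ∣) (ℕ→ℚ e) ⟩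
  ℕ→ℚ ℕ.∣ d - e ∣ ∎

outdeg+indeg≡n-1 : ∀ {n} (T : Tournament n) v →
                   ℕ→ℚ (outdeg T v) + ℕ→ℚ (indeg T v) ≡ ℕ→ℚ n - ℕ→ℚ 1
outdeg+indeg≡n-1 {n} T v = begin-equality
  d + e               ≡⟨ solve 3 (λ d e o → d :+ e := d :+ e :+ o :- o) refl d e (ℕ→ℚ 1) ⟩
  d + e + ℕ→ℚ 1 - ℕ→ℚ 1
    ≡⟨ cong (_- ℕ→ℚ 1) (trans (sym (trans (ℕ→ℚ-homo-+ (outdeg T v ℕ.+ indeg T v) 1)
                                           (cong (_+ ℕ→ℚ 1) (ℕ→ℚ-homo-+ (outdeg T v) (indeg T v)))))
                              (cong ℕ→ℚ (outdeg+indeg+1≡n T v))) ⟩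
  ℕ→ℚ n - ℕ→ℚ 1       ∎
  where
  d = ℕ→ℚ (outdeg T v)
  e = ℕ→ℚ (indeg T v)

balanced⇒∈V' : ∀ {n} (ε : ℚ) (T : Tournament n) v →
  ℕ→ℚ (imbalance T v) < ε * ℕ→ℚ n + ε * ℕ→ℚ n → inV' ε T v ≡ true
balanced⇒∈V' {n} ε T v balanced =
  cong₂ _∧_ (dec-true (lo <? d) (proj₁ d-centred)) (cong₂ _∧_ (dec-true (d <? hi) (proj₂ d-centred))
  (cong₂ _∧_ (dec-true (lo <? e) (proj₁ e-centred)) (dec-true (e <? hi) (proj₂ e-centred))))
  where
  lo hi d e : ℚ
  lo = (ℕ→ℚ n - ℕ→ℚ 1) * ½ - ε * ℕ→ℚ n
  hi = (ℕ→ℚ n - ℕ→ℚ 1) * ½ + ε * ℕ→ℚ n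
  d = ℕ→ℚ (outdeg T v)
  e = ℕ→ℚ (indeg T v)
  d-e<2k : d - e < ε * ℕ→ℚ n + ε * ℕ→ℚ n
  d-e<2k = ≤-<-trans (ℕ→ℚ-m-n≤∣m-n∣ (outdeg T v) (indeg T v)) balanced
  e-d<2k : e - d < ε * ℕ→ℚ n + ε * ℕ→ℚ n
  e-d<2k = ≤-<-trans (ℕ→ℚ-m-n≤∣m-n∣ (indeg T v) (outdeg T v))
                     (subst (λ x → ℕ→ℚ x < ε * ℕ→ℚ n + ε * ℕ→ℚ n)
                            (ℕ.∣-∣-comm (outdeg T v) (indeg T v)) balanced)
  d-centred : lo < d × d < hi
  d-centred = near-midpoint (outdeg+indeg≡n-1 T v) d-e<2k e-d<2k
  e-centred : lo < e × e < hi
  e-centred = near-midpoint (trans (+-comm e d) (outdeg+indeg≡n-1 T v)) e-d<2k d-e<2k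

∉V'⇒unbalanced : ∀ {n} (ε : ℚ) (T : Tournament n) v →
  inV' ε T v ≡ false → ε * ℕ→ℚ n + ε * ℕ→ℚ n ≤ ℕ→ℚ (imbalance T v)
∉V'⇒unbalanced ε T v ∉V' =
  ≮⇒≥ λ balanced → contradiction (trans (sym (balanced⇒∈V' ε T v balanced)) ∉V') λ ()

∑-scaled-≤ : ∀ {n} (c : ℚ) (f g : Fin n → ℕ) →
  (∀ i → c * ℕ→ℚ (f i) ≤ ℕ→ℚ (g i)) → c * ℕ→ℚ (sum f) ≤ ℕ→ℚ (sum g)
∑-scaled-≤ {zero}  c f g f≤g = ≤-reflexive (*-zeroʳ c)
∑-scaled-≤ {suc n} c f g f≤g = begin
  c * ℕ→ℚ (f zero ℕ.+ sum (f ∘ suc))         ≡⟨ cong (c *_) (ℕ→ℚ-homo-+ (f zero) (sum (f ∘ suc))) ⟩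
  c * (ℕ→ℚ (f zero) + ℕ→ℚ (sum (f ∘ suc)))   ≡⟨ *-distribˡ-+ c (ℕ→ℚ (f zero)) (ℕ→ℚ (sum (f ∘ suc))) ⟩
  c * ℕ→ℚ (f zero) + c * ℕ→ℚ (sum (f ∘ suc))
    ≤⟨ +-mono-≤ (f≤g zero) (∑-scaled-≤ c (f ∘ suc) (g ∘ suc) (f≤g ∘ suc)) ⟩
  ℕ→ℚ (g zero) + ℕ→ℚ (sum (g ∘ suc))         ≡⟨ ℕ→ℚ-homo-+ (g zero) (sum (g ∘ suc)) ⟨
  ℕ→ℚ (g zero ℕ.+ sum (g ∘ suc))             ∎

scaled-indicator-≤ : ∀ (c : ℚ) (b : Bool) (x : ℕ) →
  (b ≡ false → c ≤ ℕ→ℚ x) → c * ℕ→ℚ ⟦ not b ⟧ ≤ ℕ→ℚ x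
scaled-indicator-≤ c true  x _   = ≤-trans (≤-reflexive (*-zeroʳ c)) (ℕ→ℚ-nonNeg x)
scaled-indicator-≤ c false x c≤x = ≤-trans (≤-reflexive (*-identityʳ c)) (c≤x refl)

square-mono-≤ : ∀ {x y} → 0ℚ ≤ x → x ≤ y → x * x ≤ y * y
square-mono-≤ {x} {y} 0≤x x≤y = ≤-trans (*-monoˡ-≤-nonNeg x {{nonNegative 0≤x}} x≤y)
                                        (*-monoʳ-≤-nonNeg y {{nonNegative (≤-trans 0≤x x≤y)}} x≤y)

εn+εn-nonNeg : ∀ {ε} n → 0ℚ ≤ ε → 0ℚ ≤ ε * ℕ→ℚ n + ε * ℕ→ℚ n
εn+εn-nonNeg {ε} n 0≤ε = +-mono-≤ 0≤εn 0≤εn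
  where
  0≤εn : 0ℚ ≤ ε * ℕ→ℚ n
  0≤εn = ≤-trans (≤-reflexive (sym (*-zeroˡ (ℕ→ℚ n))))
                 (*-monoʳ-≤-nonNeg (ℕ→ℚ n) {{nonNegative (ℕ→ℚ-nonNeg n)}} 0≤ε)

unbalanced-count-bound : ∀ {n} (ε : ℚ) (T : Tournament n) → 0ℚ ≤ ε →
  (ε * ℕ→ℚ n + ε * ℕ→ℚ n) * (ε * ℕ→ℚ n + ε * ℕ→ℚ n) * ℕ→ℚ (∑[ v < n ] ⟦ not (inV' ε T v) ⟧)
    ≤ ℕ→ℚ (∑[ v < n ] (imbalance T v ℕ.* imbalance T v))
unbalanced-count-bound {n} ε T 0≤ε =
  ∑-scaled-≤ (k * k) (λ v → ⟦ not (inV' ε T v) ⟧) (λ v → imbalance T v ℕ.* imbalance T v) λ v →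
    scaled-indicator-≤ (k * k) (inV' ε T v) (imbalance T v ℕ.* imbalance T v) λ v∉V' →
      ≤-trans (square-mono-≤ (εn+εn-nonNeg n 0≤ε) (∉V'⇒unbalanced ε T v v∉V'))
              (≤-reflexive (sym (ℕ→ℚ-homo-* (imbalance T v) (imbalance T v))))
  where k = ε * ℕ→ℚ n + ε * ℕ→ℚ n

triangle-identityℚ : ∀ {n} (T : Tournament n) →
  ℕ→ℚ 24 * ℕ→ℚ (t T) + ℕ→ℚ 3 * ℕ→ℚ (∑[ v < n ] (imbalance T v ℕ.* imbalance T v)) + ℕ→ℚ n
    ≡ ℕ→ℚ n * ℕ→ℚ n * ℕ→ℚ n
triangle-identityℚ {n} T = begin-equality
  ℕ→ℚ 24 * ℕ→ℚ (t T) + ℕ→ℚ 3 * ℕ→ℚ S + ℕ→ℚ n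
    ≡⟨ cong₂ (λ a b → a + b + ℕ→ℚ n) (ℕ→ℚ-homo-* 24 (t T)) (ℕ→ℚ-homo-* 3 S) ⟨
  ℕ→ℚ (24 ℕ.* t T) + ℕ→ℚ (3 ℕ.* S) + ℕ→ℚ n
    ≡⟨ cong (_+ ℕ→ℚ n) (ℕ→ℚ-homo-+ (24 ℕ.* t T) (3 ℕ.* S)) ⟨
  ℕ→ℚ (24 ℕ.* t T ℕ.+ 3 ℕ.* S) + ℕ→ℚ n
    ≡⟨ ℕ→ℚ-homo-+ (24 ℕ.* t T ℕ.+ 3 ℕ.* S) n ⟨
  ℕ→ℚ (24 ℕ.* t T ℕ.+ 3 ℕ.* S ℕ.+ n)
    ≡⟨ cong ℕ→ℚ (triangle-identity T) ⟩
  ℕ→ℚ (n ℕ.* n ℕ.* n)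
    ≡⟨ trans (ℕ→ℚ-homo-* (n ℕ.* n) n) (cong (_* ℕ→ℚ n) (ℕ→ℚ-homo-* n n)) ⟩
  ℕ→ℚ n * ℕ→ℚ n * ℕ→ℚ n ∎
  where S = ∑[ v < n ] (imbalance T v ℕ.* imbalance T v)

imbalance-bound : ∀ {N t S δ} → 0ℚ ≤ N → ℕ→ℚ 24 * t + ℕ→ℚ 3 * S + N ≡ N * N * N →
                  ((+ 1) / 24 - δ) * (N * N * N) < t → ℕ→ℚ 3 * S < ℕ→ℚ 24 * δ * (N * N * N)
imbalance-bound {N} {t} {S} {δ} 0≤N identity many-triangles = begin-strict
  ℕ→ℚ 3 * S
    ≡⟨ solve 3 (λ N t S → con (ℕ→ℚ 3) :* S
                         := (con (ℕ→ℚ 24) :* t :+ con (ℕ→ℚ 3) :* S :+ N) :- con (ℕ→ℚ 24) :* t :- N)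
               refl N t S ⟩
  (ℕ→ℚ 24 * t + ℕ→ℚ 3 * S + N) - ℕ→ℚ 24 * t - N
    ≡⟨ cong (λ x → x - ℕ→ℚ 24 * t - N) identity ⟩
  N³ - ℕ→ℚ 24 * t - N
    ≤⟨ +-monoʳ-≤ (N³ - ℕ→ℚ 24 * t) (neg-antimono-≤ 0≤N) ⟩
  N³ - ℕ→ℚ 24 * t - 0ℚ
    ≡⟨ solve 2 (λ a b → a :- b :- con 0ℚ := a :- b) refl N³ (ℕ→ℚ 24 * t) ⟩
  N³ - ℕ→ℚ 24 * t
    <⟨ +-monoʳ-< N³ (neg-antimono-< (*-monoʳ-<-pos (ℕ→ℚ 24) many-triangles)) ⟩
  N³ - ℕ→ℚ 24 * (((+ 1) / 24 - δ) * N³)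
    ≡⟨ solve 2 (λ c δ → c :- con (ℕ→ℚ 24) :* ((con ((+ 1) / 24) :- δ) :* c) := con (ℕ→ℚ 24) :* δ :* c)
               refl N³ δ ⟩
  ℕ→ℚ 24 * δ * N³ ∎
  where N³ = N * N * N

fraction-of-complement : ∀ {B V N ε} → B + V ≡ N → V ≤ (1ℚ - ε) * N → ε * N ≤ B
fraction-of-complement {B} {V} {N} {ε} B+V≡N V≤ = begin
  ε * N               ≡⟨ solve 2 (λ ε N → ε :* N := N :- (con 1ℚ :- ε) :* N) refl ε N ⟩
  N - (1ℚ - ε) * N    ≤⟨ +-monoʳ-≤ N (neg-antimono-≤ V≤) ⟩
  N - V               ≡⟨ cong (_- V) B+V≡N ⟨
  B + V - V           ≡⟨ solve 2 (λ B V → B :+ V :- V := B) refl B V ⟩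
  B                   ∎

most-vertices-balanced : ∀ {n} (ε₁ ε₂ : ℚ) (T : Tournament n) → 0ℚ ≤ ε₂ →
  ((+ 1) / 24 - ε₁ * ε₂ * ε₂ * ½) * (ℕ→ℚ n * ℕ→ℚ n * ℕ→ℚ n) < ℕ→ℚ (t T) →
  (1ℚ - ε₁) * ℕ→ℚ n < ℕ→ℚ (sizeV' ε₂ T)
most-vertices-balanced {n} ε₁ ε₂ T 0≤ε₂ many-triangles =
  decidable-stable ((1ℚ - ε₁) * N <? ℕ→ℚ (sizeV' ε₂ T)) λ V'-small → <-irrefl refl (begin-strict
    ℕ→ℚ 3 * (c * (ε₁ * N))
      ≤⟨ *-monoˡ-≤-nonNeg (ℕ→ℚ 3) (≤-trans (*-monoˡ-≤-nonNeg c {{nonNegative 0≤c}}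
                                             (fraction-of-complement {ε = ε₁} B+V≡N (≮⇒≥ V'-small)))
                                           (unbalanced-count-bound ε₂ T 0≤ε₂)) ⟩
    ℕ→ℚ 3 * S
      <⟨ imbalance-bound {N} {ℕ→ℚ (t T)} {S} {δ} (ℕ→ℚ-nonNeg n) (triangle-identityℚ T) many-triangles ⟩
    ℕ→ℚ 24 * δ * (N * N * N)
      ≡⟨ solve 3 (λ ε₁ ε₂ N → con (ℕ→ℚ 24) :* (ε₁ :* ε₂ :* ε₂ :* con ½) :* (N :* N :* N)
                 := con (ℕ→ℚ 3) :* (((ε₂ :* N :+ ε₂ :* N) :* (ε₂ :* N :+ ε₂ :* N)) :* (ε₁ :* N))) refl ε₁ ε₂ N ⟩
    ℕ→ℚ 3 * (c * (ε₁ * N)) ∎)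
  where
  N δ c S : ℚ
  N = ℕ→ℚ n
  δ = ε₁ * ε₂ * ε₂ * ½
  c = (ε₂ * N + ε₂ * N) * (ε₂ * N + ε₂ * N)
  S = ℕ→ℚ (∑[ v < n ] (imbalance T v ℕ.* imbalance T v))
  0≤c : 0ℚ ≤ c
  0≤c = square-mono-≤ ≤-refl (εn+εn-nonNeg n 0≤ε₂)
  B+V≡N : ℕ→ℚ (∑[ v < n ] ⟦ not (inV' ε₂ T v) ⟧) + ℕ→ℚ (sizeV' ε₂ T) ≡ N
  B+V≡N = trans (sym (ℕ→ℚ-homo-+ (∑[ v < n ] ⟦ not (inV' ε₂ T v) ⟧) (sizeV' ε₂ T)))
                (cong ℕ→ℚ (count-not+count≡n (inV' ε₂ T)))

-- The argument does not need 0 < ε₁.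
lemma3p6 : (ε₁ ε₂ : ℚ) → 0ℚ < ε₁ → 0ℚ < ε₂ →
    Σ ℚ (λ δ → (ε₁ * ε₂ * ε₂ * ((+ 1) / 2) ≤ δ) ×
      ((n : ℕ) (T : Tournament n) →
        (((+ 1) / 24) - δ) * (ℕ→ℚ n * ℕ→ℚ n * ℕ→ℚ n) < ℕ→ℚ (t T) →
        (1ℚ - ε₁) * ℕ→ℚ n < ℕ→ℚ (sizeV' ε₂ T)))
lemma3p6 ε₁ ε₂ _ 0<ε₂ =
  ε₁ * ε₂ * ε₂ * ½ , ≤-refl , λ n T → most-vertices-balanced ε₁ ε₂ T (<⇒≤ 0<ε₂)
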